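{- Let $G$ be a finite group. For every finite $G$-simplicial complexes $\mathcal{K}_1$ and $\mathcal{K}_2$, there is a $G$-map from $\mathcal{F}(\mathcal{K}_1)\times\mathcal{F}(\mathcal{K}_2)$ to $\mathcal{F}(\mathcal{K}_1\boxtimes\mathcal{K}_2)$ and a $G$-map from $\mathcal{F}(\mathcal{K}_1\boxtimes\mathcal{K}_2)$ to $\mathcal{F}(\mathcal{K}_1)\times\mathcal{F}(\mathcal{K}_2)$.
   Context: $\mathcal{F}(\mathcal{K})$ is the face poset of $\mathcal{K}$: non-empty simplices ordered by inclusion, with induced $G$-action. A $G$-map between posets with order-preserving $G$-actions is an order-preserving $G$-equivariant map. Products of posets have componentwise order and diagonal action. The simplicial product $\mathcal{K}_1\boxtimes\mathcal{K}_2$ is the simplicial complex with vertex set $V(\mathcal{K}_1)\times V(\mathcal{K}_2)$ whose simplices are the non-empty sets $A\subseteq V(\mathcal{K}_1)\times V(\mathcal{K}_2)$ such that the projection $\pi_i(A)$ is a simplex of $\mathcal{K}_i$ for $i=1,2$; $G$ acts diagonally on vertices. -}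

module Defs where

open import Level using (Level; 0ℓ; _⊔_)
open import Algebra.Bundles using (Group)
open import Data.Nat using (ℕ)
open import Data.Fin using (Fin)
open import Data.Product using (Σ; ∃; ∃-syntax; _×_; _,_; proj₁; proj₂)
open import Function.Bundles using (_↔_)
open import Relation.Binary.PropositionalEquality using (_≡_; refl; sym; trans; cong)
open import Relation.Unary using (Pred; _⊆_; _≐_; Satisfiable)

IsFiniteType : Set → Set
IsFiniteType V = ∃[ n ] (Fin n ↔ V)

IsFiniteGroup : ∀ {c ℓ} → Group c ℓ → Set (c ⊔ ℓ)
IsFiniteGroup G = ∃[ n ] Σ (Fin n → Carrier) λ f → ∀ g → ∃[ i ] (f i ≈ g)
  where open Group G

record Action {c ℓ} (G : Group c ℓ) (V : Set) : Set (c ⊔ ℓ) where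
  open Group G
  field
    act      : Carrier → V → V
    act-ε    : ∀ x → act ε x ≡ x
    act-∙    : ∀ g h x → act (g ∙ h) x ≡ act g (act h x)
    act-cong : ∀ {g h} → g ≈ h → ∀ x → act g x ≡ act h x

Subset : Set → Set₁
Subset V = Pred V 0ℓ

image : {V : Set} → (V → V) → Subset V → Subset V
image f σ v = ∃[ u ] (σ u × f u ≡ v)

record GComplex {c ℓ} (G : Group c ℓ) : Set (Level.suc 0ℓ ⊔ c ⊔ ℓ) where
  open Group G
  field
    Vertex      : Set
    finite      : IsFiniteType Vertex
    action      : Action G Vertex
    IsSimplex   : Subset Vertex → Set
    nonempty    : ∀ {σ} → IsSimplex σ → Satisfiable σ
    down-closed : ∀ {σ τ} → Satisfiable σ → σ ⊆ τ → IsSimplex τ → IsSimplex σ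
    singletons  : ∀ v → IsSimplex (λ u → u ≡ v)
    invariant   : ∀ g {σ} → IsSimplex σ → IsSimplex (image (Action.act action g) σ)
  open Action action public

-- Posets with G-action (preorder with a G-action preserving the order),
-- carrying an equality for stating equivariance.
record GPoset {c ℓ} (G : Group c ℓ) : Set (Level.suc (Level.suc 0ℓ) ⊔ c ⊔ ℓ) where
  open Group G
  field
    Elem  : Set₁
    _≤_   : Elem → Elem → Set
    _≃_   : Elem → Elem → Set
    act   : Carrier → Elem → Elem

record GMap {c ℓ} {G : Group c ℓ} (P Q : GPoset G) : Set (Level.suc 0ℓ ⊔ c ⊔ ℓ) where
  private module P = GPoset P
  private module Q = GPoset Q
  open Group G
  field
    fun         : P.Elem → Q.Elem
    monotone    : ∀ {x y} → x P.≤ y → fun x Q.≤ fun y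
    equivariant : ∀ g x → fun (P.act g x) Q.≃ Q.act g (fun x)

FacePoset : ∀ {c ℓ} {G : Group c ℓ} → GComplex G → GPoset G
FacePoset {G = G} K = record
  { Elem = Σ (Subset Vertex) IsSimplex
  ; _≤_  = λ σ τ → proj₁ σ ⊆ proj₁ τ
  ; _≃_  = λ σ τ → proj₁ σ ≐ proj₁ τ
  ; act  = λ g σ → image (act g) (proj₁ σ) , invariant g (proj₂ σ)
  }
  where open GComplex K

_×P_ : ∀ {c ℓ} {G : Group c ℓ} → GPoset G → GPoset G → GPoset G
P ×P Q = record
  { Elem = P.Elem × Q.Elem
  ; _≤_  = λ x y → (proj₁ x P.≤ proj₁ y) × (proj₂ x Q.≤ proj₂ y)
  ; _≃_  = λ x y → (proj₁ x P.≃ proj₁ y) × (proj₂ x Q.≃ proj₂ y)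
  ; act  = λ g x → P.act g (proj₁ x) , Q.act g (proj₂ x)
  }
  where
  module P = GPoset P
  module Q = GPoset Q

π₁ : {V₁ V₂ : Set} → Subset (V₁ × V₂) → Subset V₁
π₁ A v = ∃[ w ] A (v , w)

π₂ : {V₁ V₂ : Set} → Subset (V₁ × V₂) → Subset V₂
π₂ A w = ∃[ v ] A (v , w)

finite-× : {A B : Set} → IsFiniteType A → IsFiniteType B → IsFiniteType (A × B)
finite-× (m , e) (n , f) = _ , ↔-trans (×-↔ {m = m} {n = n}) (×-cong e f)
  where
  open import Data.Fin.Properties using () renaming (*↔× to ×-↔)
  open import Function.Properties.Inverse using (↔-sym; ↔-trans)
  open import Data.Product.Function.NonDependent.Propositional using () renaming (_×-↔_ to ×-cong)

diagAction : ∀ {c ℓ} {G : Group c ℓ} {V₁ V₂ : Set} →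
             Action G V₁ → Action G V₂ → Action G (V₁ × V₂)
diagAction α β = record
  { act      = λ g x → A.act g (proj₁ x) , B.act g (proj₂ x)
  ; act-ε    = λ x → cong₂ _,_ (A.act-ε (proj₁ x)) (B.act-ε (proj₂ x))
  ; act-∙    = λ g h x → cong₂ _,_ (A.act-∙ g h (proj₁ x)) (B.act-∙ g h (proj₂ x))
  ; act-cong = λ p x → cong₂ _,_ (A.act-cong p (proj₁ x)) (B.act-cong p (proj₂ x))
  }
  where
  module A = Action α
  module B = Action β
  open import Relation.Binary.PropositionalEquality using (cong₂)

_⊠_ : ∀ {c ℓ} {G : Group c ℓ} → GComplex G → GComplex G → GComplex G
K₁ ⊠ K₂ = record
  { Vertex      = K₁.Vertex × K₂.Vertex
  ; finite      = finite-× K₁.finite K₂.finite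
  ; action      = diagAction K₁.action K₂.action
  ; IsSimplex   = λ A → Satisfiable A × K₁.IsSimplex (π₁ A) × K₂.IsSimplex (π₂ A)
  ; nonempty    = proj₁
  ; down-closed = λ { ((v , w) , σvw) σ⊆τ (_ , s₁ , s₂) →
        ((v , w) , σvw)
      , K₁.down-closed (v , w , σvw) (λ { (w' , p) → w' , σ⊆τ p }) s₁
      , K₂.down-closed (w , v , σvw) (λ { (v' , p) → v' , σ⊆τ p }) s₂ }
  ; singletons  = λ { (v , w) →
        ((v , w) , refl)
      , K₁.down-closed (v , w , refl) (λ { (_ , refl) → refl }) (K₁.singletons v)
      , K₂.down-closed (w , v , refl) (λ { (_ , refl) → refl }) (K₂.singletons w) }
  ; invariant   = λ { g ((x , sx) , s₁ , s₂) →
        ((_ , (x , sx , refl)))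
      , K₁.down-closed (_ , (_ , (x , sx , refl)))
          (λ { (_ , ((u₁ , u₂) , Au , refl)) → u₁ , (u₂ , Au) , refl })
          (K₁.invariant g s₁)
      , K₂.down-closed (_ , (_ , (x , sx , refl)))
          (λ { (_ , ((u₁ , u₂) , Au , refl)) → u₂ , (u₁ , Au) , refl })
          (K₂.invariant g s₂) }
  }
  where
  module K₁ = GComplex K₁
  module K₂ = GComplex K₂

-- The two maps are the rectangle (σ , τ) ↦ σ × τ and the pair of projections
-- A ↦ (π₁ A , π₂ A). Both are monotone, and both are equivariant because the
-- action on K₁ ⊠ K₂ is the product map act g × act g, which commutes with
-- forming rectangles and with taking projections.
module Submission where

open import Defs
open import Algebra.Bundles using (Group)
open import Data.Product using (_×_; _,_; proj₁; proj₂; map)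
open import Relation.Binary.PropositionalEquality using (refl)
open import Relation.Unary using (_⊆_; _≐_; _⟨×⟩_)

module _ {V₁ V₂ : Set} where

  π₁-⟨×⟩ : {σ : Subset V₁} {τ : Subset V₂} → π₁ (σ ⟨×⟩ τ) ⊆ σ
  π₁-⟨×⟩ (_ , σv , _) = σv

  π₂-⟨×⟩ : {σ : Subset V₁} {τ : Subset V₂} → π₂ (σ ⟨×⟩ τ) ⊆ τ
  π₂-⟨×⟩ (_ , _ , τw) = τw

  ⟨×⟩-mono : {σ σ′ : Subset V₁} {τ τ′ : Subset V₂} →
             σ ⊆ σ′ → τ ⊆ τ′ → (σ ⟨×⟩ τ) ⊆ (σ′ ⟨×⟩ τ′)
  ⟨×⟩-mono σ⊆σ′ τ⊆τ′ (σv , τw) = σ⊆σ′ σv , τ⊆τ′ τw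

  π₁-mono : {A B : Subset (V₁ × V₂)} → A ⊆ B → π₁ A ⊆ π₁ B
  π₁-mono A⊆B (w , a) = w , A⊆B a

  π₂-mono : {A B : Subset (V₁ × V₂)} → A ⊆ B → π₂ A ⊆ π₂ B
  π₂-mono A⊆B (v , a) = v , A⊆B a

  ⟨×⟩-image : (f : V₁ → V₁) (g : V₂ → V₂) {σ : Subset V₁} {τ : Subset V₂} →
              (image f σ ⟨×⟩ image g τ) ≐ image (map f g) (σ ⟨×⟩ τ)
  ⟨×⟩-image f g =
      (λ { ((v , σv , refl) , (w , τw , refl)) → (v , w) , (σv , τw) , refl })
    , (λ { ((v , w) , (σv , τw) , refl) → (v , σv , refl) , (w , τw , refl) })

  π₁-image : (f : V₁ → V₁) (g : V₂ → V₂) {A : Subset (V₁ × V₂)} →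
             π₁ (image (map f g) A) ≐ image f (π₁ A)
  π₁-image f g =
      (λ { (_ , (v , w) , a , refl) → v , (w , a) , refl })
    , (λ { (v , (w , a) , refl) → g w , (v , w) , a , refl })

  π₂-image : (f : V₁ → V₁) (g : V₂ → V₂) {A : Subset (V₁ × V₂)} →
             π₂ (image (map f g) A) ≐ image g (π₂ A)
  π₂-image f g =
      (λ { (_ , (v , w) , a , refl) → w , (v , a) , refl })
    , (λ { (w , (v , a) , refl) → f v , (v , w) , a , refl })

-- The subsets are passed explicitly below: _⊆_ unfolds to a pointwise
-- statement about σ (proj₁ p), from which σ cannot be recovered by unification.
module _ {c ℓ} {G : Group c ℓ} (K₁ K₂ : GComplex G) where
  private
    module K₁ = GComplex K₁
    module K₂ = GComplex K₂
    module K₁⊠K₂ = GComplex (K₁ ⊠ K₂)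

  ⟨×⟩-isSimplex : {σ : Subset K₁.Vertex} {τ : Subset K₂.Vertex} →
                  K₁.IsSimplex σ → K₂.IsSimplex τ → K₁⊠K₂.IsSimplex (σ ⟨×⟩ τ)
  ⟨×⟩-isSimplex {σ} {τ} sσ sτ with K₁.nonempty sσ | K₂.nonempty sτ
  ... | v , σv | w , τw =
      ((v , w) , σv , τw)
    , K₁.down-closed (v , w , σv , τw) (π₁-⟨×⟩ {σ = σ} {τ}) sσ
    , K₂.down-closed (w , v , σv , τw) (π₂-⟨×⟩ {σ = σ} {τ}) sτ

  rectangleMap : GMap (FacePoset K₁ ×P FacePoset K₂) (FacePoset (K₁ ⊠ K₂))
  rectangleMap = record
    { fun         = λ ((σ , sσ) , (τ , sτ)) → (σ ⟨×⟩ τ) , ⟨×⟩-isSimplex sσ sτ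
    ; monotone    = λ {((σ , _) , (τ , _))} {((σ′ , _) , (τ′ , _))} (σ⊆σ′ , τ⊆τ′) →
                      ⟨×⟩-mono {σ = σ} {σ′} {τ} {τ′} σ⊆σ′ τ⊆τ′
    ; equivariant = λ g _ → ⟨×⟩-image (K₁.act g) (K₂.act g)
    }

  projectionMap : GMap (FacePoset (K₁ ⊠ K₂)) (FacePoset K₁ ×P FacePoset K₂)
  projectionMap = record
    { fun         = λ (A , _ , s₁ , s₂) → (π₁ A , s₁) , (π₂ A , s₂)
    ; monotone    = λ {(A , _)} {(B , _)} A⊆B →
                      π₁-mono {A = A} {B} A⊆B , π₂-mono {A = A} {B} A⊆B
    ; equivariant = λ g (A , _) →
                      π₁-image (K₁.act g) (K₂.act g) {A} , π₂-image (K₁.act g) (K₂.act g) {A}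
    }

proposition3p5 : ∀ {c ℓ} (G : Group c ℓ) → IsFiniteGroup G →
    (K₁ K₂ : GComplex G) →
    GMap (FacePoset K₁ ×P FacePoset K₂) (FacePoset (K₁ ⊠ K₂))
    × GMap (FacePoset (K₁ ⊠ K₂)) (FacePoset K₁ ×P FacePoset K₂)
proposition3p5 G _ K₁ K₂ = rectangleMap K₁ K₂ , projectionMap K₁ K₂
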